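{- Let $n \geq 3$ and $r \geq 3$. Then $\Sigma_r(C_n^{c})$ is vertex decomposable, where $C_n^c$ is the complement of the cycle graph $C_n$ on $n$ vertices.
   Context: $\Sigma_r(G)$ is the simplicial complex generated by the sets $V(G)\setminus W$ over all $r$-subsets $W\subseteq V(G)$ with $G[W]$ connected (void complex if none). Vertex decomposable: the complex is a simplex, the empty complex $\{\emptyset\}$, the void complex, or has a vertex $x$ with $\mathrm{lk}(x)$ and $\mathrm{del}(x)$ vertex decomposable and every facet of $\mathrm{del}(x)$ a facet of the complex. -}

module Defs where

open import Data.Nat using (ℕ; zero; suc)
open import Data.Fin using (Fin; toℕ)
open import Data.Fin.Subset using (Subset; _∈_; _∉_; _⊆_; ∣_∣; ∁; ⁅_⁆; _∪_; ⊥)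
open import Data.Product using (Σ; ∃; _×_; _,_)
open import Data.Sum using (_⊎_)
open import Relation.Nullary using (¬_)
open import Relation.Binary.PropositionalEquality using (_≡_; _≢_)
open import Level using (Level; suc; zero)

Graph : ℕ → Set₁
Graph n = Fin n → Fin n → Set

-- Cycle graph C_n on vertices 0,…,n-1: i ~ j iff j ≡ i ± 1 (mod n).
CycleAdj : (n : ℕ) → Graph n
CycleAdj n i j =
  (ℕ.suc (toℕ i) ≡ toℕ j) ⊎ (ℕ.suc (toℕ j) ≡ toℕ i) ⊎
  ((toℕ i ≡ 0) × (ℕ.suc (toℕ j) ≡ n)) ⊎ ((toℕ j ≡ 0) × (ℕ.suc (toℕ i) ≡ n))

complement : {n : ℕ} → Graph n → Graph n
complement G i j = (i ≢ j) × ¬ G i j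

data PathIn {n : ℕ} (G : Graph n) (W : Subset n) : Fin n → Fin n → Set where
  here : ∀ {u} → u ∈ W → PathIn G W u u
  step : ∀ {u v w} → u ∈ W → G u v → PathIn G W v w → PathIn G W u w

-- G[W] is connected (W is nonempty in our use since |W| = r ≥ 3).
InducedConnected : {n : ℕ} → Graph n → Subset n → Set
InducedConnected G W = ∀ u v → u ∈ W → v ∈ W → PathIn G W u v

-- Simplicial complexes on the ground set Fin n, as (downward closed)
-- predicates on subsets.  Equality of complexes is extensional.

Complex : ℕ → Set₁
Complex n = Subset n → Set

-- Σ_r(G): generated by V(G) \ W, |W| = r, G[W] connected.
SigmaR : {n : ℕ} → ℕ → Graph n → Complex n
SigmaR r G τ = ∃ λ W → (∣ W ∣ ≡ r) × InducedConnected G W × (τ ⊆ ∁ W)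

IsFacet : {n : ℕ} → Complex n → Subset n → Set
IsFacet Δ σ = Δ σ × (∀ τ → Δ τ → σ ⊆ τ → τ ≡ σ)

-- Δ is a simplex: its faces are exactly the subsets of some σ
-- (σ = ∅ gives the empty complex {∅}).
IsSimplex : {n : ℕ} → Complex n → Set
IsSimplex Δ = ∃ λ σ → ∀ τ → (Δ τ → τ ⊆ σ) × (τ ⊆ σ → Δ τ)

IsVoid : {n : ℕ} → Complex n → Set
IsVoid Δ = ∀ τ → ¬ Δ τ

link : {n : ℕ} → Complex n → Fin n → Complex n
link Δ x τ = (x ∉ τ) × Δ (τ ∪ ⁅ x ⁆)

deletion : {n : ℕ} → Complex n → Fin n → Complex n
deletion Δ x τ = (x ∉ τ) × Δ τ

data VertexDecomposable {n : ℕ} : Complex n → Set₁ where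
  simplex : ∀ {Δ} → IsSimplex Δ → VertexDecomposable Δ
  void    : ∀ {Δ} → IsVoid Δ → VertexDecomposable Δ
  shed    : ∀ {Δ} (x : Fin n) → Δ ⁅ x ⁆ →
            VertexDecomposable (link Δ x) →
            VertexDecomposable (deletion Δ x) →
            (∀ σ → IsFacet (deletion Δ x) σ → IsFacet Δ σ) →
            VertexDecomposable Δ

{-# OPTIONS --safe #-}
-- For any family
-- 𝓕 of vertex sets, if every member W ∌ x can trade one of its elements for x
-- (exchange at x), then x is a shedding vertex of the complex generated by the
-- complements of the members of 𝓕: its link is the same construction on V − x, and
-- its deletion is the construction for the contraction 𝓕/x = {W − x : x ∈ W ∈ 𝓕}.
-- In the complement of C_n with n ≥ 5 every set of r ≥ 4 vertices is connected, so
-- Σ_r is a skeleton of a simplex.  A 3-set is connected iff none of its vertices is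
-- cycle-adjacent to both others; these triples have the exchange property at every
-- vertex, their contraction at a has it at every vertex not cycle-adjacent to a,
-- and the second contraction consists of singletons.  A failure of exchange would
-- give C_n a vertex of degree three or a 4-cycle.  For n ≤ 4 the complement has
-- maximum degree one, so there are no connected r-sets at all.
module Submission where

open import Defs
open import Data.Nat as ℕ using (ℕ; zero; suc; _+_; _≤_; _<_; z≤n; s≤s)
import Data.Nat.Properties as ℕ
open import Data.Nat.Induction using (<-wellFounded)
open import Data.Fin as Fin using (Fin; toℕ; _≟_)
import Data.Fin.Properties as Fin
open import Data.Fin.Subset
open import Data.Fin.Subset.Properties
open import Data.List using (List; []; _∷_; length)
open import Data.List.Relation.Unary.All as All using (All; []; _∷_)
open import Data.List.Relation.Unary.Unique.Propositional using (Unique; []; _∷_)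
open import Data.Product using (∃; ∃₂; _×_; _,_; proj₁; proj₂; map₂)
open import Data.Sum as Sum using (_⊎_; inj₁; inj₂; [_,_])
open import Data.Unit using (tt) renaming (⊤ to Unit)
open import Data.Vec.Base using (here; there; _∷_)
open import Function using (id; _∘_; _⇔_; mk⇔; Equivalence)
open import Induction.WellFounded using (module All)
open import Level using (0ℓ)
open import Relation.Binary.Construct.On as On using ()
open import Relation.Binary.PropositionalEquality
  using (_≡_; _≢_; refl; sym; trans; cong; subst; module ≡-Reasoning)
open import Relation.Nullary using (¬_; Dec; yes; no)
open import Relation.Nullary.Decidable using (True; toWitness; _×-dec_; _⊎-dec_; _→-dec_; ¬?)
open import Relation.Nullary.Negation using (contradiction)
open import Relation.Unary using (Pred; _≐_) renaming (Decidable to Decidable₁)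
open import Relation.Unary.Properties using (≐-sym; ≐-trans)
open import Relation.Binary.Definitions using (Symmetric; Irreflexive)

private variable
  n k : ℕ
  x y : Fin n
  p q S W σ τ : Subset n
  Δ Γ : Complex n

-- Finite sets

x∈p─q⇒x∉q : ∀ (p q : Subset n) → x ∈ p ─ q → x ∉ q
x∈p─q⇒x∉q (outside ∷ p) (inside ∷ q) () here
x∈p─q⇒x∉q (inside  ∷ p) (inside ∷ q) () here
x∈p─q⇒x∉q (_ ∷ p) (_ ∷ q) (there x∈p─q) (there x∈q) = x∈p─q⇒x∉q p q x∈p─q x∈q

x∈p-y⁻ : x ∈ p - y → x ∈ p × x ≢ y
x∈p-y⁻ {p = p} {y} x∈p-y =
  p─q⊆p p ⁅ y ⁆ x∈p-y , x∉⁅y⁆⇒x≢y (x∈p─q⇒x∉q p ⁅ y ⁆ x∈p-y)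

x∈p∪⁅y⁆⁻ : x ∈ p ∪ ⁅ y ⁆ → x ∈ p ⊎ x ≡ y
x∈p∪⁅y⁆⁻ {p = p} {y} = Sum.map₂ (x∈⁅y⁆⇒x≡y y) ∘ x∈p∪q⁻ p ⁅ y ⁆

x∈p⇒x∈p∪⁅y⁆ : x ∈ p → x ∈ p ∪ ⁅ y ⁆
x∈p⇒x∈p∪⁅y⁆ = x∈p∪q⁺ ∘ inj₁

y∈p∪⁅y⁆ : y ∈ p ∪ ⁅ y ⁆
y∈p∪⁅y⁆ {y = y} = x∈p∪q⁺ (inj₂ (x∈⁅x⁆ y))

p-x∪⁅x⁆≡p : x ∈ p → (p - x) ∪ ⁅ x ⁆ ≡ p
p-x∪⁅x⁆≡p {x = x} {p = p} x∈p = ⊆-antisym ⊆p p⊆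
  where
  ⊆p : (p - x) ∪ ⁅ x ⁆ ⊆ p
  ⊆p v∈ = [ proj₁ ∘ x∈p-y⁻ , (λ { refl → x∈p }) ] (x∈p∪⁅y⁆⁻ v∈)
  p⊆ : p ⊆ (p - x) ∪ ⁅ x ⁆
  p⊆ {v} v∈p with v ≟ x
  ... | yes refl = y∈p∪⁅y⁆
  ... | no v≢x = x∈p⇒x∈p∪⁅y⁆ (x∈p∧x≢y⇒x∈p-y v∈p v≢x)

x∉p∧y∈p⇒x≢y : x ∉ p → y ∈ p → x ≢ y
x∉p∧y∈p⇒x≢y x∉p y∈p refl = x∉p y∈p

x∉p-x : x ∉ p - x
x∉p-x x∈p-x = proj₂ (x∈p-y⁻ x∈p-x) refl

p⊆q-x⇒p⊆q : p ⊆ q - x → p ⊆ q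
p⊆q-x⇒p⊆q p⊆q-x = proj₁ ∘ x∈p-y⁻ ∘ p⊆q-x

p⊆q-x⇒x∉p : p ⊆ q - x → x ∉ p
p⊆q-x⇒x∉p p⊆q-x = x∉p-x ∘ p⊆q-x

p⊆q∧x∉p⇒p⊆q-x : p ⊆ q → x ∉ p → p ⊆ q - x
p⊆q∧x∉p⇒p⊆q-x p⊆q x∉p v∈p = x∈p∧x≢y⇒x∈p-y (p⊆q v∈p) λ { refl → x∉p v∈p }

p⊆q∧x∈q⇒p∪⁅x⁆⊆q : p ⊆ q → x ∈ q → p ∪ ⁅ x ⁆ ⊆ q
p⊆q∧x∈q⇒p∪⁅x⁆⊆q p⊆q x∈q = [ p⊆q , (λ { refl → x∈q }) ] ∘ x∈p∪⁅y⁆⁻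

x∈p∧x≢y⇒x∈p-y∪⁅z⁆ : ∀ {z} → x ∈ p → x ≢ y → x ∈ (p - y) ∪ ⁅ z ⁆
x∈p∧x≢y⇒x∈p-y∪⁅z⁆ x∈p x≢y = x∈p⇒x∈p∪⁅y⁆ (x∈p∧x≢y⇒x∈p-y x∈p x≢y)

x∈p⇒⁅x⁆⊆p : x ∈ p → ⁅ x ⁆ ⊆ p
x∈p⇒⁅x⁆⊆p {x = x} {p = p} x∈p v∈⁅x⁆ = subst (_∈ p) (sym (x∈⁅y⁆⇒x≡y x v∈⁅x⁆)) x∈p

∣p∣≡suc∣p-x∣ : ∀ (p : Subset n) → x ∈ p → ∣ p ∣ ≡ suc ∣ p - x ∣
∣p∣≡suc∣p-x∣ (inside  ∷ p) here        = cong (suc ∘ ∣_∣) (sym (p─⊥≡p p))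
∣p∣≡suc∣p-x∣ (inside  ∷ p) (there x∈p) = cong suc (∣p∣≡suc∣p-x∣ p x∈p)
∣p∣≡suc∣p-x∣ (outside ∷ p) (there x∈p) = ∣p∣≡suc∣p-x∣ p x∈p

∣p∣≤suc∣p-x∣ : ∀ (p : Subset n) x → ∣ p ∣ ≤ suc ∣ p - x ∣
∣p∣≤suc∣p-x∣ p x with x ∈? p
... | yes x∈p = ℕ.≤-reflexive (∣p∣≡suc∣p-x∣ p x∈p)
... | no  x∉p = ℕ.m≤n⇒m≤1+n (p⊆q⇒∣p∣≤∣q∣ (p⊆q∧x∉p⇒p⊆q-x {p = p} ⊆-refl x∉p))

∣p∪⁅x⁆∣≡suc∣p∣ : ∀ (p : Subset n) → x ∉ p → ∣ p ∪ ⁅ x ⁆ ∣ ≡ suc ∣ p ∣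
∣p∪⁅x⁆∣≡suc∣p∣ {x = Fin.zero}  (outside ∷ p) _   = cong (suc ∘ ∣_∣) (∪-identityʳ p)
∣p∪⁅x⁆∣≡suc∣p∣ {x = Fin.zero}  (inside  ∷ p) x∉p = contradiction here x∉p
∣p∪⁅x⁆∣≡suc∣p∣ {x = Fin.suc x} (outside ∷ p) x∉p = ∣p∪⁅x⁆∣≡suc∣p∣ p (x∉p ∘ there)
∣p∪⁅x⁆∣≡suc∣p∣ {x = Fin.suc x} (inside  ∷ p) x∉p = cong suc (∣p∪⁅x⁆∣≡suc∣p∣ p (x∉p ∘ there))

∣p-y∪⁅x⁆∣≡∣p∣ : y ∈ p → x ∉ p → ∣ (p - y) ∪ ⁅ x ⁆ ∣ ≡ ∣ p ∣
∣p-y∪⁅x⁆∣≡∣p∣ {y = y} {p = p} y∈p x∉p =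
  trans (∣p∪⁅x⁆∣≡suc∣p∣ (p - y) (x∉p ∘ proj₁ ∘ x∈p-y⁻)) (sym (∣p∣≡suc∣p-x∣ p y∈p))

∣p∣>0⇒nonempty : ∀ (p : Subset n) → 0 < ∣ p ∣ → Nonempty p
∣p∣>0⇒nonempty (inside  ∷ p) _   = Fin.zero , here
∣p∣>0⇒nonempty (outside ∷ p) 0<∣p∣ with ∣p∣>0⇒nonempty p 0<∣p∣
... | x , x∈p = Fin.suc x , there x∈p

∣p∣≡0⇒p≡⊥ : ∣ p ∣ ≡ 0 → p ≡ ⊥
∣p∣≡0⇒p≡⊥ {p = p} ∣p∣≡0 =
  Empty-unique λ (x , x∈p) → ℕ.0≢1+n (trans (sym ∣p∣≡0) (∣p∣≡suc∣p-x∣ p x∈p))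

∣p∣≡1⇒p-x∪⁅y⁆≡⁅y⁆ : ∣ p ∣ ≡ 1 → x ∈ p → (p - x) ∪ ⁅ y ⁆ ≡ ⁅ y ⁆
∣p∣≡1⇒p-x∪⁅y⁆≡⁅y⁆ {p = p} {y = y} ∣p∣≡1 x∈p = begin
  (p - _) ∪ ⁅ y ⁆ ≡⟨ cong (_∪ ⁅ y ⁆) (∣p∣≡0⇒p≡⊥ (ℕ.suc-injective (trans (sym (∣p∣≡suc∣p-x∣ p x∈p)) ∣p∣≡1))) ⟩
  ⊥ ∪ ⁅ y ⁆       ≡⟨ ∪-identityˡ ⁅ y ⁆ ⟩
  ⁅ y ⁆           ∎
  where open ≡-Reasoning

∣p∣≡1+k⇒nonempty : ∣ p ∣ ≡ suc k → Nonempty p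
∣p∣≡1+k⇒nonempty {p = p} ∣p∣≡1+k = ∣p∣>0⇒nonempty p (subst (0 <_) (sym ∣p∣≡1+k) (s≤s z≤n))

fresh : ∀ (xs : List (Fin n)) → length xs < ∣ p ∣ → ∃ λ y → y ∈ p × All (y ≢_) xs
fresh {p = p} []       0<∣p∣ = map₂ (_, []) (∣p∣>0⇒nonempty p 0<∣p∣)
fresh {p = p} (x ∷ xs) xs<∣p∣ with fresh {p = p - x} xs (ℕ.≤-pred (ℕ.≤-trans xs<∣p∣ (∣p∣≤suc∣p-x∣ p x)))
... | y , y∈p-x , y≢xs = y , proj₁ (x∈p-y⁻ y∈p-x) , proj₂ (x∈p-y⁻ y∈p-x) ∷ y≢xs

length≤∣p∣ : ∀ (xs : List (Fin n)) → Unique xs → All (_∈ p) xs → length xs ≤ ∣ p ∣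
length≤∣p∣ []       _              _            = z≤n
length≤∣p∣ {p = p} (x ∷ xs) (x≢xs ∷ xs!) (x∈p ∷ xs∈p) =
  subst (suc (length xs) ≤_) (sym (∣p∣≡suc∣p-x∣ p x∈p))
    (s≤s (length≤∣p∣ xs xs! (All.zipWith (λ (v∈p , x≢v) → x∈p∧x≢y⇒x∈p-y v∈p (x≢v ∘ sym)) (xs∈p , x≢xs))))

Distinct₃ : Fin n → Fin n → Fin n → Set
Distinct₃ p q r = p ≢ q × p ≢ r × q ≢ r

three-members : ∀ {p q r v} → ∣ W ∣ ≡ 3 → Distinct₃ p q r → All (_∈ W) (p ∷ q ∷ r ∷ []) →
  v ∈ W → v ≡ p ⊎ v ≡ q ⊎ v ≡ r
three-members {p = p} {q} {r} {v} ∣W∣≡3 (p≢q , p≢r , q≢r) pqr∈W v∈W with v ≟ p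
... | yes v≡p = inj₁ v≡p
... | no  v≢p with v ≟ q
...   | yes v≡q = inj₂ (inj₁ v≡q)
...   | no  v≢q with v ≟ r
...     | yes v≡r = inj₂ (inj₂ v≡r)
...     | no  v≢r =
  contradiction (subst (4 ≤_) ∣W∣≡3 (length≤∣p∣ (v ∷ p ∷ q ∷ r ∷ []) distinct (v∈W ∷ pqr∈W)))
                λ { (s≤s (s≤s (s≤s ()))) }
  where
  distinct : Unique (v ∷ p ∷ q ∷ r ∷ [])
  distinct = (v≢p ∷ v≢q ∷ v≢r ∷ []) ∷ (p≢q ∷ p≢r ∷ []) ∷ (q≢r ∷ []) ∷ [] ∷ []

distinct-triple : 3 ≤ ∣ W ∣ → ∃₂ λ p q → ∃ λ r → Distinct₃ p q r × All (_∈ W) (p ∷ q ∷ r ∷ [])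
distinct-triple 3≤∣W∣ with fresh [] (ℕ.≤-trans (s≤s z≤n) 3≤∣W∣)
... | p , p∈W , [] with fresh (p ∷ []) (ℕ.≤-trans (s≤s (s≤s z≤n)) 3≤∣W∣)
... | q , q∈W , q≢p ∷ [] with fresh (p ∷ q ∷ []) 3≤∣W∣
... | r , r∈W , r≢p ∷ r≢q ∷ [] = p , q , r , (q≢p ∘ sym , r≢p ∘ sym , r≢q ∘ sym) , p∈W ∷ q∈W ∷ r∈W ∷ []

-- Simplicial complexes

link-resp-≐ : Δ ≐ Γ → link Δ x ≐ link Γ x
link-resp-≐ (Δ⊆Γ , Γ⊆Δ) = map₂ Δ⊆Γ , map₂ Γ⊆Δ

deletion-resp-≐ : Δ ≐ Γ → deletion Δ x ≐ deletion Γ x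
deletion-resp-≐ (Δ⊆Γ , Γ⊆Δ) = map₂ Δ⊆Γ , map₂ Γ⊆Δ

isFacet-resp-≐ : Δ ≐ Γ → IsFacet Δ σ → IsFacet Γ σ
isFacet-resp-≐ (Δ⊆Γ , Γ⊆Δ) (σ∈Δ , maximal) = Δ⊆Γ σ∈Δ , λ τ → maximal τ ∘ Γ⊆Δ

vd-resp-≐ : Δ ≐ Γ → VertexDecomposable Δ → VertexDecomposable Γ
vd-resp-≐ (Δ⊆Γ , Γ⊆Δ) (simplex (σ , faces)) =
  simplex (σ , λ τ → proj₁ (faces τ) ∘ Γ⊆Δ , Δ⊆Γ ∘ proj₂ (faces τ))
vd-resp-≐ (_ , Γ⊆Δ) (void empty) = void λ τ → empty τ ∘ Γ⊆Δ
vd-resp-≐ Δ≐Γ@(Δ⊆Γ , _) (shed x x∈Δ vdₗ vdₔ facets) =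
  shed x (Δ⊆Γ x∈Δ) (vd-resp-≐ (link-resp-≐ Δ≐Γ) vdₗ) (vd-resp-≐ (deletion-resp-≐ Δ≐Γ) vdₔ)
    λ σ → isFacet-resp-≐ Δ≐Γ ∘ facets σ ∘ isFacet-resp-≐ (deletion-resp-≐ (≐-sym Δ≐Γ))

non-vertex-deletion : (∀ {σ τ} → σ ⊆ τ → Δ τ → Δ σ) → ¬ Δ ⁅ x ⁆ → deletion Δ x ≐ Δ
non-vertex-deletion downClosed x∉Δ = proj₂ , λ τ∈Δ → (λ x∈τ → x∉Δ (downClosed (x∈p⇒⁅x⁆⊆p x∈τ) τ∈Δ)) , τ∈Δ

Family : ℕ → Set₁
Family n = Pred (Subset n) 0ℓ

private variable
  𝓕 𝓖 : Family n

-- The complex on S whose facets are the sets S ─ W with W ∈ 𝓕 and W ⊆ S.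
avoiding : Family n → Subset n → Complex n
avoiding 𝓕 S τ = τ ⊆ S × ∃ λ W → 𝓕 W × W ⊆ S × τ ⊆ ∁ W

infixl 7 _/_
_/_ : Family n → Fin n → Family n
(𝓕 / x) W = x ∉ W × 𝓕 (W ∪ ⁅ x ⁆)

Exchange : Family n → Fin n → Set
Exchange 𝓕 x = ∀ {W} → 𝓕 W → x ∉ W → ∃ λ y → y ∈ W × 𝓕 ((W - y) ∪ ⁅ x ⁆)

Uniform : ℕ → Family n → Set
Uniform k 𝓕 = ∀ {W} → 𝓕 W → ∣ W ∣ ≡ k

/-decidable : Decidable₁ 𝓕 → Decidable₁ (𝓕 / x)
/-decidable {x = x} 𝓕? W = ¬? (x ∈? W) ×-dec 𝓕? (W ∪ ⁅ x ⁆)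

/-uniform : Uniform (suc k) 𝓕 → Uniform k (𝓕 / x)
/-uniform uniform (x∉W , Wx∈𝓕) = ℕ.suc-injective (trans (sym (∣p∪⁅x⁆∣≡suc∣p∣ _ x∉W)) (uniform Wx∈𝓕))

avoiding? : Decidable₁ 𝓕 → Decidable₁ (avoiding 𝓕 S)
avoiding? {S = S} 𝓕? τ = τ ⊆? S ×-dec anySubset? λ W → 𝓕? W ×-dec W ⊆? S ×-dec τ ⊆? ∁ W

avoiding-downClosed : σ ⊆ τ → avoiding 𝓕 S τ → avoiding 𝓕 S σ
avoiding-downClosed σ⊆τ (τ⊆S , W , W∈𝓕 , W⊆S , τ⊆∁W) = τ⊆S ∘ σ⊆τ , W , W∈𝓕 , W⊆S , τ⊆∁W ∘ σ⊆τ

avoiding-cong : (∀ {W} → W ⊆ S → 𝓕 W ⇔ 𝓖 W) → avoiding 𝓕 S ≐ avoiding 𝓖 S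
avoiding-cong 𝓕⇔𝓖 =
  (λ (τ⊆S , W , W∈𝓕 , W⊆S , τ⊆∁W) → τ⊆S , W , Equivalence.to (𝓕⇔𝓖 W⊆S) W∈𝓕 , W⊆S , τ⊆∁W) ,
  (λ (τ⊆S , W , W∈𝓖 , W⊆S , τ⊆∁W) → τ⊆S , W , Equivalence.from (𝓕⇔𝓖 W⊆S) W∈𝓖 , W⊆S , τ⊆∁W)

avoiding-simplex : 𝓕 ⊥ → IsSimplex (avoiding 𝓕 S)
avoiding-simplex {S = S} ∅∈𝓕 =
  S , λ τ → proj₁ , λ τ⊆S → τ⊆S , ⊥ , ∅∈𝓕 , ⊆-min S , λ _ → x∉p⇒x∈∁p ∉⊥

avoiding-void : (∀ {W} → 𝓕 W → W ⊈ S) → IsVoid (avoiding 𝓕 S)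
avoiding-void none _ (_ , _ , W∈𝓕 , W⊆S , _) = none W∈𝓕 W⊆S

vd-uniform₀ : Decidable₁ 𝓕 → Uniform 0 𝓕 → VertexDecomposable (avoiding 𝓕 S)
vd-uniform₀ {𝓕 = 𝓕} 𝓕? uniform with 𝓕? ⊥
... | yes ∅∈𝓕 = simplex (avoiding-simplex ∅∈𝓕)
... | no  ∅∉𝓕 = void (avoiding-void λ W∈𝓕 _ → ∅∉𝓕 (subst 𝓕 (∣p∣≡0⇒p≡⊥ (uniform W∈𝓕)) W∈𝓕))

link-avoiding : x ∈ S → link (avoiding 𝓕 S) x ≐ avoiding 𝓕 (S - x)
link-avoiding x∈S =
  (λ (x∉τ , τx⊆S , W , W∈𝓕 , W⊆S , τx⊆∁W) →
     p⊆q∧x∉p⇒p⊆q-x (τx⊆S ∘ x∈p⇒x∈p∪⁅y⁆) x∉τ , W , W∈𝓕 ,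
     p⊆q∧x∉p⇒p⊆q-x W⊆S (x∈∁p⇒x∉p (τx⊆∁W y∈p∪⁅y⁆)) , τx⊆∁W ∘ x∈p⇒x∈p∪⁅y⁆) ,
  (λ (τ⊆S-x , W , W∈𝓕 , W⊆S-x , τ⊆∁W) →
     p⊆q-x⇒x∉p τ⊆S-x , p⊆q∧x∈q⇒p∪⁅x⁆⊆q (p⊆q-x⇒p⊆q τ⊆S-x) x∈S , W , W∈𝓕 , p⊆q-x⇒p⊆q W⊆S-x ,
     p⊆q∧x∈q⇒p∪⁅x⁆⊆q τ⊆∁W (x∉p⇒x∈∁p (p⊆q-x⇒x∉p W⊆S-x)))

contraction-below : Exchange 𝓕 x → 𝓕 W →
  ∃ λ W' → (𝓕 / x) W' × W' ⊆ W × (x ∉ W → ∃ λ y → y ∈ W × y ∉ W')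
contraction-below {𝓕 = 𝓕} {x = x} {W = W} exchange W∈𝓕 with x ∈? W
... | yes x∈W = W - x , (x∉p-x , subst 𝓕 (sym (p-x∪⁅x⁆≡p x∈W)) W∈𝓕) , p─q⊆p W ⁅ x ⁆ , contradiction x∈W
... | no  x∉W with exchange W∈𝓕 x∉W
...   | y , y∈W , W-y+x∈𝓕 =
  W - y , (x∉W ∘ proj₁ ∘ x∈p-y⁻ , W-y+x∈𝓕) , p─q⊆p W ⁅ y ⁆ , λ _ → y , y∈W , x∉p-x

deletion-avoiding : x ∈ S → Exchange 𝓕 x → deletion (avoiding 𝓕 S) x ≐ avoiding (𝓕 / x) (S - x)
deletion-avoiding {x = x} {S = S} {𝓕 = 𝓕} x∈S exchange = to , from
  where
  to : ∀ {τ} → deletion (avoiding 𝓕 S) x τ → avoiding (𝓕 / x) (S - x) τ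
  to (x∉τ , τ⊆S , W , W∈𝓕 , W⊆S , τ⊆∁W) with contraction-below exchange W∈𝓕
  ... | W' , (x∉W' , W'x∈𝓕) , W'⊆W , _ =
    p⊆q∧x∉p⇒p⊆q-x τ⊆S x∉τ , W' , (x∉W' , W'x∈𝓕) , p⊆q∧x∉p⇒p⊆q-x (W⊆S ∘ W'⊆W) x∉W' ,
    p⊆q⇒∁p⊇∁q W'⊆W ∘ τ⊆∁W
  from : ∀ {τ} → avoiding (𝓕 / x) (S - x) τ → deletion (avoiding 𝓕 S) x τ
  from (τ⊆S-x , W' , (x∉W' , W'x∈𝓕) , W'⊆S-x , τ⊆∁W') =
    p⊆q-x⇒x∉p τ⊆S-x , p⊆q-x⇒p⊆q τ⊆S-x , W' ∪ ⁅ x ⁆ , W'x∈𝓕 ,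
    p⊆q∧x∈q⇒p∪⁅x⁆⊆q (p⊆q-x⇒p⊆q W'⊆S-x) x∈S ,
    λ v∈τ → x∉p⇒x∈∁p ([ x∈∁p⇒x∉p (τ⊆∁W' v∈τ) , (λ { refl → p⊆q-x⇒x∉p τ⊆S-x v∈τ }) ] ∘ x∈p∪⁅y⁆⁻)

-- If σ ∪ {x} avoids W ∈ 𝓕, exchanging x into W frees a vertex y ∈ W that can
-- be added to σ without using x.
deletion-extends : x ∈ S → Exchange 𝓕 x → x ∉ σ → avoiding 𝓕 S (σ ∪ ⁅ x ⁆) →
  ∃ λ y → y ∉ σ × deletion (avoiding 𝓕 S) x (σ ∪ ⁅ y ⁆)
deletion-extends {x = x} {σ = σ} x∈S exchange x∉σ (σx⊆S , W , W∈𝓕 , W⊆S , σx⊆∁W) =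
  let W' , W'∈𝓕/x , W'⊆W , missing = contraction-below exchange W∈𝓕
      y , y∈W , y∉W' = missing x∉W
      σ⊆S-x = p⊆q∧x∉p⇒p⊆q-x (σx⊆S ∘ x∈p⇒x∈p∪⁅y⁆) x∉σ
      y∈S-x = p⊆q∧x∉p⇒p⊆q-x W⊆S x∉W y∈W
  in y , (λ y∈σ → x∈∁p⇒x∉p (σ⊆∁W y∈σ) y∈W) ,
     proj₂ (deletion-avoiding x∈S exchange)
       (p⊆q∧x∈q⇒p∪⁅x⁆⊆q σ⊆S-x y∈S-x , W' , W'∈𝓕/x ,
        p⊆q∧x∉p⇒p⊆q-x (W⊆S ∘ W'⊆W) (proj₁ W'∈𝓕/x) ,
        p⊆q∧x∈q⇒p∪⁅x⁆⊆q (p⊆q⇒∁p⊇∁q W'⊆W ∘ σ⊆∁W) (x∉p⇒x∈∁p y∉W'))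
  where
  σ⊆∁W : σ ⊆ ∁ W
  σ⊆∁W = σx⊆∁W ∘ x∈p⇒x∈p∪⁅y⁆
  x∉W : x ∉ W
  x∉W = x∈∁p⇒x∉p (σx⊆∁W y∈p∪⁅y⁆)

deletion-facets : x ∈ S → Exchange 𝓕 x →
  IsFacet (deletion (avoiding 𝓕 S) x) σ → IsFacet (avoiding 𝓕 S) σ
deletion-facets {x = x} {S = S} {𝓕 = 𝓕} {σ = σ} x∈S exchange ((x∉σ , σ∈Δ) , maximal) = σ∈Δ , grow
  where
  grow : ∀ τ → avoiding 𝓕 S τ → σ ⊆ τ → τ ≡ σ
  grow τ τ∈Δ σ⊆τ with x ∈? τ
  ... | no  x∉τ = maximal τ (x∉τ , τ∈Δ) σ⊆τ
  ... | yes x∈τ =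
    let y , y∉σ , σy∈del = deletion-extends x∈S exchange x∉σ
                             (avoiding-downClosed (p⊆q∧x∈q⇒p∪⁅x⁆⊆q σ⊆τ x∈τ) τ∈Δ)
    in contradiction (subst (y ∈_) (maximal _ σy∈del x∈p⇒x∈p∪⁅y⁆) y∈p∪⁅y⁆) y∉σ

shedding-step : Decidable₁ 𝓕 → x ∈ S → Exchange 𝓕 x →
  VertexDecomposable (avoiding 𝓕 (S - x)) → VertexDecomposable (avoiding (𝓕 / x) (S - x)) →
  VertexDecomposable (avoiding 𝓕 S)
shedding-step {x = x} 𝓕? x∈S exchange vdₗ vdₔ with avoiding? 𝓕? ⁅ x ⁆
... | yes x∈Δ = shed x x∈Δ (vd-resp-≐ (≐-sym (link-avoiding x∈S)) vdₗ)
                  (vd-resp-≐ (≐-sym (deletion-avoiding x∈S exchange)) vdₔ)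
                  (λ _ → deletion-facets x∈S exchange)
... | no  x∉Δ = vd-resp-≐ (≐-trans (≐-sym (deletion-avoiding x∈S exchange))
                                   (non-vertex-deletion avoiding-downClosed x∉Δ)) vdₔ

vd-by-shedding : {P : Pred (Fin n) 0ℓ} → Decidable₁ 𝓕 → Decidable₁ P →
  (∀ {W} → 𝓕 W → ∃ λ x → x ∈ W × P x) →
  (∀ {x} → P x → Exchange 𝓕 x) →
  (∀ {x S} → P x → x ∉ S → VertexDecomposable (avoiding (𝓕 / x) S)) →
  ∀ S → VertexDecomposable (avoiding 𝓕 S)
vd-by-shedding {𝓕 = 𝓕} {P = P} 𝓕? P? covered exchange contracted =
  All.wfRec (On.wellFounded ∣_∣ <-wellFounded) _ (VertexDecomposable ∘ avoiding 𝓕) decompose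
  where
  decompose : ∀ S → (∀ {T} → ∣ T ∣ < ∣ S ∣ → VertexDecomposable (avoiding 𝓕 T)) →
              VertexDecomposable (avoiding 𝓕 S)
  decompose S smaller with Fin.any? (λ x → x ∈? S ×-dec P? x)
  ... | yes (x , x∈S , Px) =
    shedding-step 𝓕? x∈S (exchange Px) (smaller (x∈p⇒∣p-x∣<∣p∣ x∈S)) (contracted Px x∉p-x)
  ... | no  none = void (avoiding-void λ W∈𝓕 W⊆S →
    let x , x∈W , Px = covered W∈𝓕 in none (x , W⊆S x∈W , Px))

vd-uniform₁ : Decidable₁ 𝓕 → Uniform 1 𝓕 → ∀ S → VertexDecomposable (avoiding 𝓕 S)
vd-uniform₁ {𝓕 = 𝓕} 𝓕? uniform =
  vd-by-shedding 𝓕? (λ x → 𝓕? ⁅ x ⁆) covered exchange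
    λ _ _ → vd-uniform₀ (/-decidable 𝓕?) (/-uniform {𝓕 = 𝓕} uniform)
  where
  covered : ∀ {W} → 𝓕 W → ∃ λ x → x ∈ W × 𝓕 ⁅ x ⁆
  covered {W} W∈𝓕 =
    let x , x∈W = ∣p∣≡1+k⇒nonempty (uniform {W} W∈𝓕)
    in x , x∈W , subst 𝓕 (trans (sym (p-x∪⁅x⁆≡p x∈W)) (∣p∣≡1⇒p-x∪⁅y⁆≡⁅y⁆ (uniform {W} W∈𝓕) x∈W)) W∈𝓕
  exchange : ∀ {x} → 𝓕 ⁅ x ⁆ → Exchange 𝓕 x
  exchange x∈𝓕 {W} W∈𝓕 _ =
    let y , y∈W = ∣p∣≡1+k⇒nonempty (uniform {W} W∈𝓕)
    in y , y∈W , subst 𝓕 (sym (∣p∣≡1⇒p-x∪⁅y⁆≡⁅y⁆ (uniform {W} W∈𝓕) y∈W)) x∈𝓕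

Sized : ℕ → Family n
Sized k W = ∣ W ∣ ≡ k

vd-sized : ∀ k S → VertexDecomposable (avoiding (Sized {n} k) S)
vd-sized {n} zero _ = simplex (avoiding-simplex (∣⊥∣≡0 n))
vd-sized (suc k) = vd-by-shedding (λ W → ∣ W ∣ ℕ.≟ suc k) (λ _ → yes tt) covered exchange contracted
  where
  covered : ∀ {W} → Sized (suc k) W → ∃ λ x → x ∈ W × Unit
  covered = map₂ (_, tt) ∘ ∣p∣≡1+k⇒nonempty
  exchange : ∀ {x} → Unit → Exchange (Sized (suc k)) x
  exchange _ ∣W∣≡1+k x∉W =
    let y , y∈W = ∣p∣≡1+k⇒nonempty ∣W∣≡1+k in y , y∈W , trans (∣p-y∪⁅x⁆∣≡∣p∣ y∈W x∉W) ∣W∣≡1+k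
  contracted : ∀ {x S} → Unit → x ∉ S → VertexDecomposable (avoiding (Sized (suc k) / x) S)
  contracted {S = S} _ x∉S = vd-resp-≐ (avoiding-cong λ W⊆S → mk⇔
    (λ ∣W∣≡k → x∉S ∘ W⊆S , trans (∣p∪⁅x⁆∣≡suc∣p∣ _ (x∉S ∘ W⊆S)) (cong suc ∣W∣≡k))
    (/-uniform id)) (vd-sized k S)

-- Graphs

ConnectedSets : ℕ → Graph n → Family n
ConnectedSets r G W = ∣ W ∣ ≡ r × InducedConnected G W

sigmaR≐avoiding : ∀ r (G : Graph n) → SigmaR r G ≐ avoiding (ConnectedSets r G) ⊤
sigmaR≐avoiding r G =
  (λ (W , ∣W∣≡r , connected , τ⊆∁W) → (λ _ → ∈⊤) , W , (∣W∣≡r , connected) , (λ _ → ∈⊤) , τ⊆∁W) ,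
  (λ (_ , W , (∣W∣≡r , connected) , _ , τ⊆∁W) → W , ∣W∣≡r , connected , τ⊆∁W)

NoIsolated : Graph n → Subset n → Set
NoIsolated G W = ∀ v → v ∈ W → ∃ λ u → u ∈ W × G v u

AtMostOneNeighbour : Graph n → Set
AtMostOneNeighbour G = ∀ {u v w} → G u v → G u w → v ≡ w

complement? : {G : Graph n} → (∀ i j → Dec (G i j)) → ∀ i j → Dec (complement G i j)
complement? G? i j = ¬? (i ≟ j) ×-dec ¬? (G? i j)

complement-sym : {G : Graph n} → Symmetric G → Symmetric (complement G)
complement-sym G-sym (i≢j , ¬ij) = i≢j ∘ sym , ¬ij ∘ G-sym

complement-irrefl : {G : Graph n} → Irreflexive _≡_ (complement G)
complement-irrefl i≡j (i≢j , _) = i≢j i≡j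

noIsolated? : {G : Graph n} → (∀ i j → Dec (G i j)) → Decidable₁ (NoIsolated G)
noIsolated? G? W = Fin.all? λ v → v ∈? W →-dec Fin.any? λ u → u ∈? W ×-dec G? v u

module _ {G : Graph n} where

  path-start : ∀ {u v} → PathIn G W u v → u ∈ W
  path-start (here u∈W)     = u∈W
  path-start (step u∈W _ _) = u∈W

  path-snoc : ∀ {u v w} → PathIn G W u v → G v w → w ∈ W → PathIn G W u w
  path-snoc (here v∈W)          vw w∈W = step v∈W vw (here w∈W)
  path-snoc (step u∈W uu' rest) vw w∈W = step u∈W uu' (path-snoc rest vw w∈W)

  path-reverse : Symmetric G → ∀ {u v} → PathIn G W u v → PathIn G W v u
  path-reverse G-sym (here u∈W)          = here u∈W
  path-reverse G-sym (step u∈W uu' rest) = path-snoc (path-reverse G-sym rest) (G-sym uu') u∈W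

  connected⇒noIsolated : 2 ≤ ∣ W ∣ → InducedConnected G W → NoIsolated G W
  connected⇒noIsolated 2≤∣W∣ connected v v∈W with fresh (v ∷ []) 2≤∣W∣
  ... | u , u∈W , u≢v ∷ [] with connected v u v∈W u∈W
  ...   | here _          = contradiction refl u≢v
  ...   | step _ vw rest = _ , path-start rest , vw

  noIsolated₃⇒connected : Symmetric G → Irreflexive _≡_ G → ∣ W ∣ ≡ 3 → NoIsolated G W →
    InducedConnected G W
  noIsolated₃⇒connected G-sym irrefl ∣W∣≡3 noIsolated u v u∈W v∈W with u ≟ v
  ... | yes refl = here u∈W
  ... | no  u≢v with noIsolated u u∈W
  ...   | u' , u'∈W , uu' with u' ≟ v
  ...     | yes refl = step u∈W uu' (here v∈W)
  ...     | no  u'≢v with noIsolated v v∈W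
  ...       | v' , v'∈W , vv' with three-members ∣W∣≡3 (u≢v , (λ u≡u' → irrefl u≡u' uu') , u'≢v ∘ sym)
                                                   (u∈W ∷ v∈W ∷ u'∈W ∷ []) v'∈W
  ...         | inj₁ refl        = step u∈W (G-sym vv') (here v∈W)
  ...         | inj₂ (inj₁ refl) = contradiction vv' (irrefl refl)
  ...         | inj₂ (inj₂ refl) = step u∈W uu' (step u'∈W (G-sym vv') (here v∈W))

  reachable-near : Symmetric G → AtMostOneNeighbour G → ∀ {u a b} → PathIn G W a b →
    a ≡ u ⊎ G u a → b ≡ u ⊎ G u b
  reachable-near G-sym unique (here _)         near        = near
  reachable-near G-sym unique (step _ ab rest) (inj₁ refl) = reachable-near G-sym unique rest (inj₂ ab)
  reachable-near G-sym unique (step _ ab rest) (inj₂ ua)   =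
    reachable-near G-sym unique rest (inj₁ (sym (unique (G-sym ua) ab)))

  no-connected-triple : Symmetric G → AtMostOneNeighbour G → InducedConnected G W → ¬ 3 ≤ ∣ W ∣
  no-connected-triple {W = W} G-sym unique connected 3≤∣W∣ with distinct-triple 3≤∣W∣
  ... | u , v , w , (u≢v , u≢w , v≢w) , u∈W ∷ v∈W ∷ w∈W ∷ [] =
    v≢w (unique (neighbour v∈W (u≢v ∘ sym)) (neighbour w∈W (u≢w ∘ sym)))
    where
    neighbour : ∀ {t} → t ∈ W → t ≢ u → G u t
    neighbour t∈W t≢u with reachable-near G-sym unique (connected u _ u∈W t∈W) (inj₁ refl)
    ... | inj₁ t≡u = contradiction t≡u t≢u
    ... | inj₂ ut  = ut

-- The cycle C_n and its complement

module _ {n : ℕ} where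

  private
    C : Graph n
    C = CycleAdj n

  C? : ∀ i j → Dec (C i j)
  C? i j = (suc (toℕ i) ℕ.≟ toℕ j) ⊎-dec ((suc (toℕ j) ℕ.≟ toℕ i) ⊎-dec
           (((toℕ i ℕ.≟ 0) ×-dec (suc (toℕ j) ℕ.≟ n)) ⊎-dec ((toℕ j ℕ.≟ 0) ×-dec (suc (toℕ i) ℕ.≟ n))))

  C-sym : Symmetric C
  C-sym (inj₁ e)                = inj₂ (inj₁ e)
  C-sym (inj₂ (inj₁ e))         = inj₁ e
  C-sym (inj₂ (inj₂ (inj₁ e)))  = inj₂ (inj₂ (inj₂ e))
  C-sym (inj₂ (inj₂ (inj₂ e)))  = inj₂ (inj₂ (inj₁ e))

  Cᶜ-sym : Symmetric (complement C)
  Cᶜ-sym = complement-sym C-sym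

  Succ : Fin n → Fin n → Set
  Succ i j = suc (toℕ i) ≡ toℕ j ⊎ (suc (toℕ i) ≡ n × toℕ j ≡ 0)

  C⇒Succ : ∀ {i j} → C i j → Succ i j ⊎ Succ j i
  C⇒Succ (inj₁ e)                      = inj₁ (inj₁ e)
  C⇒Succ (inj₂ (inj₁ e))               = inj₂ (inj₁ e)
  C⇒Succ (inj₂ (inj₂ (inj₁ (i≡0 , j)))) = inj₂ (inj₂ (j , i≡0))
  C⇒Succ (inj₂ (inj₂ (inj₂ (j≡0 , i)))) = inj₁ (inj₂ (i , j≡0))

  Succ-functional : ∀ {x y z} → Succ x y → Succ x z → y ≡ z
  Succ-functional (inj₁ e) (inj₁ e') = Fin.toℕ-injective (trans (sym e) e')
  Succ-functional {y = y} (inj₁ e) (inj₂ (e' , _)) = contradiction (trans (sym e) e') (ℕ.<⇒≢ (Fin.toℕ<n y))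
  Succ-functional {z = z} (inj₂ (e , _)) (inj₁ e') = contradiction (trans (sym e') e) (ℕ.<⇒≢ (Fin.toℕ<n z))
  Succ-functional (inj₂ (_ , y≡0)) (inj₂ (_ , z≡0)) = Fin.toℕ-injective (trans y≡0 (sym z≡0))

  Succ-injective : ∀ {x y z} → Succ x z → Succ y z → x ≡ y
  Succ-injective (inj₁ e)         (inj₁ e')         = Fin.toℕ-injective (ℕ.suc-injective (trans e (sym e')))
  Succ-injective (inj₁ e)         (inj₂ (_ , z≡0))  = contradiction (trans e z≡0) ℕ.1+n≢0
  Succ-injective (inj₂ (_ , z≡0)) (inj₁ e)          = contradiction (trans e z≡0) ℕ.1+n≢0
  Succ-injective (inj₂ (e , _))   (inj₂ (e' , _))   = Fin.toℕ-injective (ℕ.suc-injective (trans e (sym e')))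

  infixl 5 _▷_
  data SuccWalk : ℕ → Fin n → Fin n → Set where
    []  : ∀ {a} → SuccWalk 0 a a
    _▷_ : ∀ {k a b c} → SuccWalk k a b → Succ b c → SuccWalk (suc k) a c

  -- A walk of length k < n winds around the cycle at most once.
  walk-offset : ∀ {k a b} → SuccWalk k a b → k < n → toℕ b ≡ toℕ a + k ⊎ toℕ b + n ≡ toℕ a + k
  walk-offset {a = a} [] _ = inj₁ (sym (ℕ.+-identityʳ (toℕ a)))
  walk-offset {suc k} {a} (_▷_ {b = b} walk b→c) k<n
    with walk-offset walk (ℕ.<-trans (ℕ.n<1+n k) k<n) | b→c
  ... | inj₁ e | inj₁ e' = inj₁ (trans (sym e') (trans (cong suc e) (sym (ℕ.+-suc (toℕ a) k))))
  ... | inj₁ e | inj₂ (e' , c≡0) =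
    inj₂ (trans (cong (_+ n) c≡0) (trans (sym e') (trans (cong suc e) (sym (ℕ.+-suc (toℕ a) k)))))
  ... | inj₂ e | inj₁ e' = inj₂ (trans (cong (_+ n) (sym e')) (trans (cong suc e) (sym (ℕ.+-suc (toℕ a) k))))
  ... | inj₂ e | inj₂ (e' , _) = contradiction (sym e) (ℕ.<⇒≢ (ℕ.+-mono-≤-< a≤b (ℕ.<-trans (ℕ.n<1+n k) k<n)))
    where
    a≤b : toℕ a ≤ toℕ b
    a≤b = ℕ.≤-pred (subst (toℕ a <_) (sym e') (Fin.toℕ<n a))

  no-short-cycle : ∀ {k a} → SuccWalk (suc k) a a → ¬ suc k < n
  no-short-cycle {k} {a} walk k<n with walk-offset walk k<n
  ... | inj₁ e = ℕ.m≢1+m+n (toℕ a) (trans e (ℕ.+-suc (toℕ a) k))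
  ... | inj₂ e = ℕ.<⇒≢ k<n (sym (ℕ.+-cancelˡ-≡ (toℕ a) _ _ e))

  Succ-irrefl : 2 ≤ n → ∀ {x} → ¬ Succ x x
  Succ-irrefl _ (inj₁ e) = ℕ.1+n≢n e
  Succ-irrefl 2≤n (inj₂ (x+1≡n , x≡0)) = ℕ.<⇒≢ 2≤n (trans (cong suc (sym x≡0)) x+1≡n)

  C-irrefl : 2 ≤ n → Irreflexive _≡_ C
  C-irrefl 2≤n refl xx = [ Succ-irrefl 2≤n , Succ-irrefl 2≤n ] (C⇒Succ xx)

  C-orient : ∀ {x y z} → C x y → C y z → x ≢ z → (Succ x y × Succ y z) ⊎ (Succ y x × Succ z y)
  C-orient xy yz x≢z with C⇒Succ xy | C⇒Succ yz
  ... | inj₁ x→y | inj₁ y→z = inj₁ (x→y , y→z)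
  ... | inj₂ y→x | inj₂ z→y = inj₂ (y→x , z→y)
  ... | inj₁ x→y | inj₂ z→y = contradiction (Succ-injective x→y z→y) x≢z
  ... | inj₂ y→x | inj₁ y→z = contradiction (Succ-functional y→x y→z) x≢z

  C-degree≤2 : ∀ {x p q r} → C x p → C x q → C x r → ¬ Distinct₃ p q r
  C-degree≤2 xp xq xr (p≢q , p≢r , q≢r) with C⇒Succ xp | C⇒Succ xq | C⇒Succ xr
  ... | inj₁ x→p | inj₁ x→q | _         = p≢q (Succ-functional x→p x→q)
  ... | inj₂ p→x | inj₂ q→x | _         = p≢q (Succ-injective p→x q→x)
  ... | inj₁ x→p | inj₂ _   | inj₁ x→r  = p≢r (Succ-functional x→p x→r)
  ... | inj₁ _   | inj₂ q→x | inj₂ r→x  = q≢r (Succ-injective q→x r→x)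
  ... | inj₂ _   | inj₁ x→q | inj₁ x→r  = q≢r (Succ-functional x→q x→r)
  ... | inj₂ p→x | inj₁ _   | inj₂ r→x  = p≢r (Succ-injective p→x r→x)

  C-triangle-free : 4 ≤ n → ∀ {a b c} → C a b → C b c → ¬ C c a
  C-triangle-free 4≤n ab bc ca with C-orient ab bc (λ a≡c → C-irrefl 2≤n (sym a≡c) ca) | C⇒Succ ca
    where 2≤n = ℕ.≤-trans (s≤s (s≤s z≤n)) 4≤n
  ... | inj₁ (a→b , b→c) | inj₁ c→a = no-short-cycle ([] ▷ a→b ▷ b→c ▷ c→a) 4≤n
  ... | inj₂ (b→a , c→b) | inj₂ a→c = no-short-cycle ([] ▷ c→b ▷ b→a ▷ a→c) 4≤n
  ... | inj₁ (a→b , _)   | inj₂ a→c = C-irrefl (ℕ.≤-trans (s≤s (s≤s z≤n)) 4≤n) (Succ-functional a→b a→c) bc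
  ... | inj₂ (_ , c→b)   | inj₁ c→a = C-irrefl (ℕ.≤-trans (s≤s (s≤s z≤n)) 4≤n) (Succ-functional c→a c→b) ab

  C-square-free : 5 ≤ n → ∀ {a b c d} → C a b → C b c → C c d → C d a → ¬ (a ≢ c × b ≢ d)
  C-square-free 5≤n ab bc cd da (a≢c , b≢d) with C-orient ab bc a≢c | C-orient cd da (a≢c ∘ sym)
  ... | inj₁ (a→b , b→c) | inj₁ (c→d , d→a) = no-short-cycle ([] ▷ a→b ▷ b→c ▷ c→d ▷ d→a) 5≤n
  ... | inj₂ (b→a , c→b) | inj₂ (d→c , a→d) = no-short-cycle ([] ▷ a→d ▷ d→c ▷ c→b ▷ b→a) 5≤n
  ... | inj₁ (a→b , _)   | inj₂ (_ , a→d)   = b≢d (Succ-functional a→b a→d)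
  ... | inj₂ (_ , c→b)   | inj₁ (c→d , _)   = b≢d (Succ-functional c→b c→d)

  -- The centre is then isolated in the complement of C.
  Centred : Fin n → Fin n → Fin n → Set
  Centred p q r = (C p q × C p r) ⊎ (C q p × C q r) ⊎ (C r p × C r q)

  Spread : Fin n → Fin n → Fin n → Set
  Spread p q r = Distinct₃ p q r × ¬ Centred p q r

  Centred? : ∀ p q r → Dec (Centred p q r)
  Centred? p q r = (C? p q ×-dec C? p r) ⊎-dec ((C? q p ×-dec C? q r) ⊎-dec (C? r p ×-dec C? r q))

  Centred-swap₂₃ : ∀ {p q r} → Centred p q r → Centred p r q
  Centred-swap₂₃ (inj₁ (pq , pr))        = inj₁ (pr , pq)
  Centred-swap₂₃ (inj₂ (inj₁ centre-q)) = inj₂ (inj₂ centre-q)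
  Centred-swap₂₃ (inj₂ (inj₂ centre-r)) = inj₂ (inj₁ centre-r)

  Centred-centre : ∀ {u v w} → ¬ C u w → Centred u v w → C v u × C v w
  Centred-centre ¬uw (inj₁ (_ , uw))        = contradiction uw ¬uw
  Centred-centre ¬uw (inj₂ (inj₁ centre-v)) = centre-v
  Centred-centre ¬uw (inj₂ (inj₂ (wu , _))) = contradiction (C-sym wu) ¬uw

  -- The centres of the three triples would give a vertex of degree three or a 4-cycle.
  not-all-centred : 5 ≤ n → ∀ {x p q r} → x ≢ p → x ≢ q → x ≢ r → Distinct₃ p q r →
    Centred x p q → Centred x p r → ¬ Centred x q r
  not-all-centred 5≤n {x} {p} {q} {r} x≢p x≢q x≢r (p≢q , p≢r , q≢r) xpq xpr xqr with C? x r
  ... | no ¬xr =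
    let px , pr = Centred-centre ¬xr xpr
        qx , qr = Centred-centre ¬xr xqr
    in C-square-free 5≤n (C-sym px) pr (C-sym qr) qx (x≢r , p≢q)
  ... | yes xr with C? x q
  ...   | no ¬xq =
    let px , pq = Centred-centre ¬xq xpq
        rx , rq = Centred-centre ¬xq (Centred-swap₂₃ xqr)
    in C-square-free 5≤n (C-sym px) pq (C-sym rq) rx (x≢q , p≢r)
  ...   | yes xq with C? x p
  ...     | no ¬xp =
    let qx , qp = Centred-centre ¬xp (Centred-swap₂₃ xpq)
        rx , rp = Centred-centre ¬xp (Centred-swap₂₃ xpr)
    in C-square-free 5≤n (C-sym qx) qp (C-sym rp) rx (x≢p , q≢r)
  ...     | yes xp = C-degree≤2 xp xq xr (p≢q , p≢r , q≢r)

  spread-exchange : 5 ≤ n → ∀ {x p q r} → Distinct₃ p q r → x ≢ p → x ≢ q → x ≢ r →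
    Spread x p q ⊎ Spread x p r ⊎ Spread x q r
  spread-exchange 5≤n {x} {p} {q} {r} pqr@(p≢q , p≢r , q≢r) x≢p x≢q x≢r
    with Centred? x p q | Centred? x p r | Centred? x q r
  ... | no ¬xpq | _       | _       = inj₁ ((x≢p , x≢q , p≢q) , ¬xpq)
  ... | yes _   | no ¬xpr | _       = inj₂ (inj₁ ((x≢p , x≢r , p≢r) , ¬xpr))
  ... | yes _   | yes _   | no ¬xqr = inj₂ (inj₂ ((x≢q , x≢r , q≢r) , ¬xqr))
  ... | yes xpq | yes xpr | yes xqr = contradiction xqr (not-all-centred 5≤n x≢p x≢q x≢r pqr xpq xpr)

  spread-exchange-fixing : 5 ≤ n → ∀ {a x p q} → Distinct₃ a p q → x ≢ a → ¬ C a x → x ≢ p → x ≢ q →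
    Spread a x p ⊎ Spread a x q
  spread-exchange-fixing 5≤n {a} {x} {p} {q} (a≢p , a≢q , p≢q) x≢a ¬ax x≢p x≢q
    with Centred? a x p | Centred? a x q
  ... | no ¬axp | _       = inj₁ ((x≢a ∘ sym , a≢p , x≢p) , ¬axp)
  ... | yes _   | no ¬axq = inj₂ ((x≢a ∘ sym , a≢q , x≢q) , ¬axq)
  ... | yes axp | yes axq =
    let pa , px = Centred-centre ¬ax (Centred-swap₂₃ axp)
        qa , qx = Centred-centre ¬ax (Centred-swap₂₃ axq)
    in contradiction (x≢a ∘ sym , p≢q) (C-square-free 5≤n (C-sym pa) px (C-sym qx) qa)

  -- Given adjacent u, v and a member w₁ adjacent to u only, a detour through a
  -- further member w₂ avoids C-edges: otherwise C would have a triangle, a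
  -- vertex of degree three, or a 4-cycle.
  detour : 5 ≤ n → ∀ {u v w₁ w₂} → u ∈ W → v ∈ W → w₁ ∈ W → w₂ ∈ W →
    All (w₁ ≢_) (u ∷ v ∷ []) → All (w₂ ≢_) (u ∷ v ∷ w₁ ∷ []) →
    C u v → C u w₁ → ¬ C v w₁ → PathIn (complement C) W u v
  detour 5≤n {u} {v} {w₁} {w₂} u∈W v∈W w₁∈W w₂∈W (w₁≢u ∷ w₁≢v ∷ []) (w₂≢u ∷ w₂≢v ∷ w₂≢w₁ ∷ []) uv uw₁ ¬vw₁
    with C? v w₂
  ... | yes vw₂ =
    step u∈W (w₂≢u ∘ sym , λ uw₂ → C-triangle-free (ℕ.≤-trans (ℕ.n≤1+n 4) 5≤n) uv vw₂ (C-sym uw₂))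
      (step w₂∈W (w₂≢w₁ , λ w₂w₁ →
                    C-square-free 5≤n uw₁ (C-sym w₂w₁) (C-sym vw₂) (C-sym uv) (w₂≢u ∘ sym , w₁≢v))
        (step w₁∈W (w₁≢v , ¬vw₁ ∘ C-sym) (here v∈W)))
  ... | no ¬vw₂ with C? u w₂
  ...   | no  ¬uw₂ = step u∈W (w₂≢u ∘ sym , ¬uw₂) (step w₂∈W (w₂≢v , ¬vw₂ ∘ C-sym) (here v∈W))
  ...   | yes uw₂  = contradiction (w₁≢v ∘ sym , w₂≢v ∘ sym , w₂≢w₁ ∘ sym) (C-degree≤2 uv uw₁ uw₂)

  large-connected : 5 ≤ n → 4 ≤ ∣ W ∣ → InducedConnected (complement C) W
  large-connected 5≤n 4≤∣W∣ u v u∈W v∈W with u ≟ v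
  ... | yes refl = here u∈W
  ... | no  u≢v with C? u v
  ...   | no  ¬uv = step u∈W (u≢v , ¬uv) (here v∈W)
  ...   | yes uv with fresh (u ∷ v ∷ []) (ℕ.≤-trans (ℕ.n≤1+n 3) 4≤∣W∣)
  ...     | w₁ , w₁∈W , w₁≢@(w₁≢u ∷ w₁≢v ∷ []) with fresh (u ∷ v ∷ w₁ ∷ []) 4≤∣W∣
  ...       | w₂ , w₂∈W , w₂≢@(w₂≢u ∷ w₂≢v ∷ w₂≢w₁ ∷ []) with C? u w₁ | C? v w₁
  ... | no ¬uw₁ | no ¬vw₁ = step u∈W (w₁≢u ∘ sym , ¬uw₁) (step w₁∈W (w₁≢v , ¬vw₁ ∘ C-sym) (here v∈W))
  ... | yes uw₁ | yes vw₁ = contradiction (C-sym uw₁) (C-triangle-free (ℕ.≤-trans (ℕ.n≤1+n 4) 5≤n) uv vw₁)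
  ... | yes uw₁ | no ¬vw₁ = detour 5≤n u∈W v∈W w₁∈W w₂∈W w₁≢ w₂≢ uv uw₁ ¬vw₁
  ... | no ¬uw₁ | yes vw₁ = path-reverse (Cᶜ-sym)
    (detour 5≤n v∈W u∈W w₁∈W w₂∈W (w₁≢v ∷ w₁≢u ∷ []) (w₂≢v ∷ w₂≢u ∷ w₂≢w₁ ∷ []) (C-sym uv) vw₁ ¬uw₁)

  sigmaR≐avoiding-sized : 5 ≤ n → ∀ {r} → 3 < r → SigmaR r (complement C) ≐ avoiding (Sized r) ⊤
  sigmaR≐avoiding-sized 5≤n 3<r = ≐-trans (sigmaR≐avoiding _ _) (avoiding-cong λ _ →
    mk⇔ proj₁ λ ∣W∣≡r → ∣W∣≡r , large-connected 5≤n (subst (4 ≤_) (sym ∣W∣≡r) 3<r))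

  SpreadSets : Family n
  SpreadSets W = ∣ W ∣ ≡ 3 × NoIsolated (complement C) W

  spreadSets? : Decidable₁ SpreadSets
  spreadSets? W = ∣ W ∣ ℕ.≟ 3 ×-dec noIsolated? (complement? C?) W

  sigmaR₃≐avoiding-spreadSets : SigmaR 3 (complement C) ≐ avoiding SpreadSets ⊤
  sigmaR₃≐avoiding-spreadSets = ≐-trans (sigmaR≐avoiding 3 _) (avoiding-cong λ _ → mk⇔
    (λ (∣W∣≡3 , connected) →
       ∣W∣≡3 , connected⇒noIsolated (subst (2 ≤_) (sym ∣W∣≡3) (s≤s (s≤s z≤n))) connected)
    (λ (∣W∣≡3 , noIsolated) →
       ∣W∣≡3 , noIsolated₃⇒connected Cᶜ-sym (complement-irrefl {G = C}) ∣W∣≡3 noIsolated))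

  spreadSets⇒spread : SpreadSets W → ∀ {p q r} → Distinct₃ p q r → All (_∈ W) (p ∷ q ∷ r ∷ []) → Spread p q r
  spreadSets⇒spread {W = W} (∣W∣≡3 , noIsolated) {p} {q} {r} pqr@(p≢q , p≢r , q≢r) (p∈W ∷ q∈W ∷ r∈W ∷ []) =
    pqr , not-centred
    where
    not-isolated : ∀ {c s t} → Distinct₃ c s t → c ∈ W → s ∈ W → t ∈ W → ¬ (C c s × C c t)
    not-isolated cst c∈W s∈W t∈W (cs , ct) with noIsolated _ c∈W
    ... | u , u∈W , c≢u , ¬cu with three-members ∣W∣≡3 cst (c∈W ∷ s∈W ∷ t∈W ∷ []) u∈W
    ...   | inj₁ refl        = c≢u refl
    ...   | inj₂ (inj₁ refl) = ¬cu cs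
    ...   | inj₂ (inj₂ refl) = ¬cu ct
    not-centred : ¬ Centred p q r
    not-centred (inj₁ centre-p)        = not-isolated pqr p∈W q∈W r∈W centre-p
    not-centred (inj₂ (inj₁ centre-q)) = not-isolated (p≢q ∘ sym , q≢r , p≢r) q∈W p∈W r∈W centre-q
    not-centred (inj₂ (inj₂ centre-r)) = not-isolated (p≢r ∘ sym , q≢r ∘ sym , p≢q) r∈W p∈W q∈W centre-r

  spread⇒spreadSets : ∣ W ∣ ≡ 3 → ∀ {p q r} → All (_∈ W) (p ∷ q ∷ r ∷ []) → Spread p q r → SpreadSets W
  spread⇒spreadSets {W = W} ∣W∣≡3 pqr∈W@(p∈W ∷ q∈W ∷ r∈W ∷ []) (pqr@(p≢q , p≢r , q≢r) , ¬centred) =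
    ∣W∣≡3 , noIsolated
    where
    non-neighbour : ∀ {c s t} → ¬ (C c s × C c t) → c ≢ s → c ≢ t → s ∈ W → t ∈ W →
      ∃ λ u → u ∈ W × complement C c u
    non-neighbour {c} {s} {t} ¬cst c≢s c≢t s∈W t∈W with C? c s | C? c t
    ... | no  ¬cs | _       = s , s∈W , c≢s , ¬cs
    ... | yes _   | no  ¬ct = t , t∈W , c≢t , ¬ct
    ... | yes cs  | yes ct  = contradiction (cs , ct) ¬cst
    noIsolated : NoIsolated (complement C) W
    noIsolated v v∈W with three-members ∣W∣≡3 pqr pqr∈W v∈W
    ... | inj₁ refl        = non-neighbour (¬centred ∘ inj₁) p≢q p≢r q∈W r∈W
    ... | inj₂ (inj₁ refl) = non-neighbour (¬centred ∘ inj₂ ∘ inj₁) (p≢q ∘ sym) q≢r p∈W r∈W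
    ... | inj₂ (inj₂ refl) = non-neighbour (¬centred ∘ inj₂ ∘ inj₂) (p≢r ∘ sym) (q≢r ∘ sym) p∈W q∈W

  exchanged-spreadSet : ∣ W ∣ ≡ 3 → x ∉ W → y ∈ W → ∀ {s t} → s ∈ W → t ∈ W → s ≢ y → t ≢ y →
    Spread x s t → SpreadSets ((W - y) ∪ ⁅ x ⁆)
  exchanged-spreadSet ∣W∣≡3 x∉W y∈W s∈W t∈W s≢y t≢y = spread⇒spreadSets
    (trans (∣p-y∪⁅x⁆∣≡∣p∣ y∈W x∉W) ∣W∣≡3)
    (y∈p∪⁅y⁆ ∷ x∈p∧x≢y⇒x∈p-y∪⁅z⁆ s∈W s≢y ∷ x∈p∧x≢y⇒x∈p-y∪⁅z⁆ t∈W t≢y ∷ [])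

  spreadSets-exchange : 5 ≤ n → Exchange SpreadSets x
  spreadSets-exchange {x = x} 5≤n {W} (∣W∣≡3 , _) x∉W with distinct-triple (ℕ.≤-reflexive (sym ∣W∣≡3))
  ... | p , q , r , pqr@(p≢q , p≢r , q≢r) , p∈W ∷ q∈W ∷ r∈W ∷ []
    with spread-exchange 5≤n pqr (x∉p∧y∈p⇒x≢y x∉W p∈W) (x∉p∧y∈p⇒x≢y x∉W q∈W) (x∉p∧y∈p⇒x≢y x∉W r∈W)
  ... | inj₁ xpq        = r , r∈W , exchanged-spreadSet ∣W∣≡3 x∉W r∈W p∈W q∈W p≢r q≢r xpq
  ... | inj₂ (inj₁ xpr) = q , q∈W , exchanged-spreadSet ∣W∣≡3 x∉W q∈W p∈W r∈W p≢q (q≢r ∘ sym) xpr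
  ... | inj₂ (inj₂ xqr) = p , p∈W , exchanged-spreadSet ∣W∣≡3 x∉W p∈W q∈W r∈W (p≢q ∘ sym) (p≢r ∘ sym) xqr

  spread-pair : ∀ {a} → (SpreadSets / a) W → ∃₂ λ p q → Spread a p q × p ∈ W × q ∈ W
  spread-pair {W = W} {a} W∈@(a∉W , Wa∈) with /-uniform {𝓕 = SpreadSets} proj₁ W∈
  ... | ∣W∣≡2 with fresh [] (subst (1 ≤_) (sym ∣W∣≡2) (s≤s z≤n))
  ... | p , p∈W , [] with fresh (p ∷ []) (ℕ.≤-reflexive (sym ∣W∣≡2))
  ... | q , q∈W , q≢p ∷ [] =
    p , q , spreadSets⇒spread Wa∈ (x∉p∧y∈p⇒x≢y a∉W p∈W , x∉p∧y∈p⇒x≢y a∉W q∈W , q≢p ∘ sym)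
              (y∈p∪⁅y⁆ ∷ x∈p⇒x∈p∪⁅y⁆ p∈W ∷ x∈p⇒x∈p∪⁅y⁆ q∈W ∷ []) , p∈W , q∈W

  spreadSets/-covered : ∀ {a} → (SpreadSets / a) W → ∃ λ x → x ∈ W × (x ≢ a × ¬ C a x)
  spreadSets/-covered {a = a} W∈ with spread-pair W∈
  ... | p , q , ((a≢p , a≢q , _) , ¬centred) , p∈W , q∈W with C? a p | C? a q
  ... | no  ¬ap | _       = p , p∈W , a≢p ∘ sym , ¬ap
  ... | yes _   | no  ¬aq = q , q∈W , a≢q ∘ sym , ¬aq
  ... | yes ap  | yes aq  = contradiction (inj₁ (ap , aq)) ¬centred

  exchanged-spreadSet/ : ∀ {a} → (SpreadSets / a) W → x ≢ a → x ∉ W → y ∈ W → ∀ {s} → s ∈ W → s ≢ y →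
    Spread a x s → (SpreadSets / a) ((W - y) ∪ ⁅ x ⁆)
  exchanged-spreadSet/ {W = W} {x = x} {y = y} {a = a} W∈@(a∉W , _) x≢a x∉W y∈W s∈W s≢y axs =
    a∉W' , spread⇒spreadSets card
      (y∈p∪⁅y⁆ ∷ x∈p⇒x∈p∪⁅y⁆ y∈p∪⁅y⁆ ∷ x∈p⇒x∈p∪⁅y⁆ (x∈p∧x≢y⇒x∈p-y∪⁅z⁆ s∈W s≢y) ∷ []) axs
    where
    a∉W' : a ∉ (W - y) ∪ ⁅ x ⁆
    a∉W' = [ a∉W ∘ proj₁ ∘ x∈p-y⁻ , x≢a ∘ sym ] ∘ x∈p∪⁅y⁆⁻
    card : ∣ ((W - y) ∪ ⁅ x ⁆) ∪ ⁅ a ⁆ ∣ ≡ 3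
    card = trans (∣p∪⁅x⁆∣≡suc∣p∣ _ a∉W')
                 (cong suc (trans (∣p-y∪⁅x⁆∣≡∣p∣ y∈W x∉W) (/-uniform {𝓕 = SpreadSets} proj₁ W∈)))

  spreadSets/-exchange : 5 ≤ n → ∀ {a} → x ≢ a → ¬ C a x → Exchange (SpreadSets / a) x
  spreadSets/-exchange {x = x} 5≤n {a} x≢a ¬ax {W} W∈ x∉W with spread-pair W∈
  ... | p , q , (apq@(_ , _ , p≢q) , _) , p∈W , q∈W
    with spread-exchange-fixing 5≤n apq x≢a ¬ax (x∉p∧y∈p⇒x≢y x∉W p∈W) (x∉p∧y∈p⇒x≢y x∉W q∈W)
  ... | inj₁ axp = q , q∈W , exchanged-spreadSet/ W∈ x≢a x∉W q∈W p∈W p≢q axp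
  ... | inj₂ axq = p , p∈W , exchanged-spreadSet/ W∈ x≢a x∉W p∈W q∈W (p≢q ∘ sym) axq

  vd-spreadSets// : ∀ a b S → VertexDecomposable (avoiding (SpreadSets / a / b) S)
  vd-spreadSets// a b = vd-uniform₁ (/-decidable (/-decidable spreadSets?))
    (/-uniform {𝓕 = SpreadSets / a} (/-uniform {𝓕 = SpreadSets} proj₁))

  vd-spreadSets/ : 5 ≤ n → ∀ a S → VertexDecomposable (avoiding (SpreadSets / a) S)
  vd-spreadSets/ 5≤n a = vd-by-shedding (/-decidable spreadSets?) (λ x → ¬? (x ≟ a) ×-dec ¬? (C? a x))
    spreadSets/-covered (λ (x≢a , ¬ax) → spreadSets/-exchange 5≤n x≢a ¬ax)
    λ {x} _ _ → vd-spreadSets// a x _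

  vd-spreadSets : 5 ≤ n → ∀ S → VertexDecomposable (avoiding SpreadSets S)
  vd-spreadSets 5≤n = vd-by-shedding spreadSets? (λ _ → yes tt) (map₂ (_, tt) ∘ ∣p∣≡1+k⇒nonempty ∘ proj₁)
    (λ _ → spreadSets-exchange 5≤n) (λ {x} _ _ → vd-spreadSets/ 5≤n x _)

  complement-matching? : Dec (∀ u v w → complement C u v → complement C u w → v ≡ w)
  complement-matching? = Fin.all? λ u → Fin.all? λ v → Fin.all? λ w →
    complement? C? u v →-dec complement? C? u w →-dec v ≟ w

cycle-complement-matching : n ≤ 4 → AtMostOneNeighbour (complement (CycleAdj n))
cycle-complement-matching n≤4 {u} {v} {w} = toWitness (checked n≤4) u v w
  where
  checked : ∀ {n} → n ≤ 4 → True (complement-matching? {n})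
  checked z≤n                         = tt
  checked (s≤s z≤n)                   = tt
  checked (s≤s (s≤s z≤n))             = tt
  checked (s≤s (s≤s (s≤s z≤n)))       = tt
  checked (s≤s (s≤s (s≤s (s≤s z≤n)))) = tt

cycle-complement-sigmaR-void : n ≤ 4 → ∀ {r} → 3 ≤ r → IsVoid (SigmaR r (complement (CycleAdj n)))
cycle-complement-sigmaR-void n≤4 3≤r _ (W , ∣W∣≡r , connected , _) =
  no-connected-triple Cᶜ-sym (cycle-complement-matching n≤4) connected
    (subst (3 ≤_) (sym ∣W∣≡r) 3≤r)

theorem4p12 : (n r : ℕ) → 3 ≤ n → 3 ≤ r →
    VertexDecomposable (SigmaR r (complement (CycleAdj n)))
theorem4p12 n r _ 3≤r with n ℕ.≤? 4 | ℕ.m≤n⇒m<n∨m≡n 3≤r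
... | yes n≤4 | _         = void (cycle-complement-sigmaR-void n≤4 3≤r)
... | no  n≰4 | inj₂ refl = vd-resp-≐ (≐-sym sigmaR₃≐avoiding-spreadSets) (vd-spreadSets (ℕ.≰⇒> n≰4) ⊤)
... | no  n≰4 | inj₁ 3<r  = vd-resp-≐ (≐-sym (sigmaR≐avoiding-sized (ℕ.≰⇒> n≰4) 3<r)) (vd-sized r ⊤)
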